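{- Fix a monitoring window $k\ge1$. The function $\mathsf{step}$ is total, and, starting from an initial blockchain run, after the first $k$ invocations each execution of $\mathsf{step}$ makes exactly one transaction permanent (i.e. extends the history by exactly one step).
   Context: Blockchain model with future monitors. A configuration is a triple $(\Sigma,\Delta,\mathcal U)$ where $\Sigma$ is a blockchain state, $\mathcal U$ the balances of external users, and $\Delta$ a future-monitor context assigning to each contract $c$ a failing map $\mathsf{failmap}_c$ from transaction identifiers to $\{\mathrm{None},\mathrm{Fail},\mathrm{Commit},\mathrm{Undecided}\}$ and a timeout value $\mathsf{timeout}_c(t)\in\{\mathrm{Fail},\mathrm{Commit}\}$. A transaction-execution function $\mathsf{applyTx}(t,n)$ returns either $\mathrm{commit}(n_c)$, $\mathrm{fail}(n_f)$, or $\mathrm{pending}(n_c,n_f)$. A monitoring tree is a finite rooted directed tree whose nodes are configurations; each internal node $n$ has one or two children, all edges out of $n$ are labelled by the same transaction $\mathsf{nextTx}(n)$, and two children are distinguished as committing and failing successor, rooting the committing and failing subtrees. Height = number of edges on a longest root-to-leaf path. A blockchain run is a pair $(H,\tau)$, $H$ a sequence of configurations linked by transactions (history, whose transactions are called permanent) ending in the root of $\tau$; an initial run has $H_0=\tau_0$ a single configuration. For a leaf $l$ and transaction $t$: $\mathrm{MC}(l,t)=\{c:\mathsf{failmap}_c(t)\neq\mathrm{None}\}$ in $l$; $\mathsf{allMonitoringCommit}(l,t)$ iff all $c\in\mathrm{MC}(l,t)$ have $\mathsf{failmap}_c(t)=\mathrm{Commit}$; $\mathsf{oneMonitoringFail}(l,t)$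 iff some $c\in\mathrm{MC}(l,t)$ has $\mathsf{failmap}_c(t)=\mathrm{Fail}$; $\mathsf{allMonitoringCommitWithTimeout}(l,t)$ iff every $c\in\mathrm{MC}(l,t)$ has $\mathsf{failmap}_c(t)=\mathrm{Commit}$ or ($\mathrm{Undecided}$ and $\mathsf{timeout}_c(t)=\mathrm{Commit}$). $\mathsf{extend}(\tau,t)$: to each leaf $l$ attach, via edges labelled $t$, the single child $l_c$ if $\mathsf{applyTx}(t,l)=\mathrm{commit}(l_c)$, the single child $l_f$ if $\mathrm{fail}(l_f)$, or committing child $l_c$ and failing child $l_f$ if $\mathrm{pending}(l_c,l_f)$. $\mathsf{innerprune}(\tau)$: a leaf is returned unchanged; with $t=\mathsf{nextTx}(\mathrm{root})$, a root with one successor subtree $\tau_1$ gets the single child $\mathsf{innerprune}(\tau_1)$; a root with subtrees $\tau_c,\tau_f$: let $\tau'_c,\tau'_f$ be their innerprunes; if all leaves of $\tau'_c$ satisfy $\mathsf{allMonitoringCommit}(\cdot,t)$ keep only $\tau'_c$; else if all leaves of $\tau'_c$ satisfy $\mathsf{oneMonitoringFail}(\cdot,t)$ keep only $\tau'_f$; else keep both. $\mathsf{prune}(\tau)$ (height $k+1$): $\tau'=\mathsf{innerprune}(\tau)$; if the root of $\tau'$ has one successor subtree return it; if two, $(\tau_c,\tau_f)$, return $\tau_c$ if every leaf $l$ of $\tau_c$ satisfies $\mathsf{allMonitoringCommitWithTimeout}(l,\mathsf{nextTx}(\mathrm{root}))$, else $\tau_f$. $\mathsf{step}((H,\tau),t)$: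 $\tau'=\mathsf{extend}(\tau,t)$; if height$(\tau')\le k$ return $(H,\tau')$; else $\tau''=\mathsf{prune}(\tau')$, append $\mathrm{root}(\tau)\xrightarrow{\mathsf{nextTx}(\mathrm{root}(\tau))}\mathrm{root}(\tau'')$ to $H$, return $(H,\tau'')$. -}

module Defs where

open import Data.Nat using (ℕ; zero; suc; _≤_; _⊔_; _≤?_)
open import Data.Bool using (Bool; true; false; _∧_; _∨_)
open import Data.List using (List; []; _∷_; _++_)
open import Data.Bool.ListAction using (all; any)
open import Data.Maybe using (Maybe; just; nothing; _>>=_)
open import Data.Product using (_×_; _,_)
open import Relation.Nullary using (yes; no)

data FailVal : Set where
  None Fail Commit Undecided : FailVal

data TimeoutVal : Set where
  tFail tCommit : TimeoutVal

data TxResult (C : Set) : Set where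
  commit  : C → TxResult C
  fail    : C → TxResult C
  pending : C → C → TxResult C

-- A configuration (Σ, Δ, U) is abstract; the
-- future-monitor context Δ is observed through the (finite) list of
-- contracts it assigns a monitor to, and their failmap / timeout.
record Model : Set₁ where
  field
    Config   : Set
    Tx       : Set
    Contract : Set
    contracts : Config → List Contract
    failmap   : Config → Contract → Tx → FailVal
    timeout   : Config → Contract → Tx → TimeoutVal
    applyTx   : Tx → Config → TxResult Config

module _ (M : Model) where
  open Model M

  -- Monitoring trees: leaf, internal node with one child, internal node
  -- with committing and failing children.  Edges out of a node carry the
  -- node's unique label nextTx.
  data Tree : Set where
    leaf  : Config → Tree
    node1 : Config → Tx → Tree → Tree
    node2 : Config → Tx → Tree → Tree → Tree   -- committing, failing

  root : Tree → Config
  root (leaf c)          = c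
  root (node1 c _ _)     = c
  root (node2 c _ _ _)   = c

  nextTx : Tree → Maybe Tx
  nextTx (leaf _)        = nothing
  nextTx (node1 _ t _)   = just t
  nextTx (node2 _ t _ _) = just t

  height : Tree → ℕ
  height (leaf _)          = 0
  height (node1 _ _ τ)     = suc (height τ)
  height (node2 _ _ τ₁ τ₂) = suc (height τ₁ ⊔ height τ₂)

  leaves : Tree → List Config
  leaves (leaf c)          = c ∷ []
  leaves (node1 _ _ τ)     = leaves τ
  leaves (node2 _ _ τ₁ τ₂) = leaves τ₁ ++ leaves τ₂

  -- Per-contract predicates.  Contracts with failmap = None are not in MC
  -- and hence impose no constraint.
  isCommitOrNone : FailVal → Bool
  isCommitOrNone None   = true
  isCommitOrNone Commit = true
  isCommitOrNone _      = false

  isFail : FailVal → Bool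
  isFail Fail = true
  isFail _    = false

  commitWithTimeout : FailVal → TimeoutVal → Bool
  commitWithTimeout None      _       = true
  commitWithTimeout Commit    _       = true
  commitWithTimeout Undecided tCommit = true
  commitWithTimeout _         _       = false

  allMonitoringCommit : Config → Tx → Bool
  allMonitoringCommit l t = all (λ c → isCommitOrNone (failmap l c t)) (contracts l)

  oneMonitoringFail : Config → Tx → Bool
  oneMonitoringFail l t = any (λ c → isFail (failmap l c t)) (contracts l)

  allMonitoringCommitWithTimeout : Config → Tx → Bool
  allMonitoringCommitWithTimeout l t =
    all (λ c → commitWithTimeout (failmap l c t) (timeout l c t)) (contracts l)

  extend : Tree → Tx → Tree
  extend (leaf l) t with applyTx t l
  ... | commit lc     = node1 l t (leaf lc)
  ... | fail lf       = node1 l t (leaf lf)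
  ... | pending lc lf = node2 l t (leaf lc) (leaf lf)
  extend (node1 c t' τ) t       = node1 c t' (extend τ t)
  extend (node2 c t' τc τf) t   = node2 c t' (extend τc t) (extend τf t)

  innerprune : Tree → Tree
  innerprune (leaf l)       = leaf l
  innerprune (node1 c t τ)  = node1 c t (innerprune τ)
  innerprune (node2 c t τc τf) =
    choose (all (λ l → allMonitoringCommit l t) (leaves τc'))
           (all (λ l → oneMonitoringFail l t) (leaves τc'))
    where
      τc' = innerprune τc
      τf' = innerprune τf
      choose : Bool → Bool → Tree
      choose true  _     = node1 c t τc'
      choose false true  = node1 c t τf'
      choose false false = node2 c t τc' τf'

  prune : Tree → Maybe Tree
  prune τ = go (innerprune τ)
    where
      go : Tree → Maybe Tree
      go (leaf _)          = nothing
      go (node1 _ _ τ₁)    = just τ₁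
      go (node2 _ t τc τf) with all (λ l → allMonitoringCommitWithTimeout l t) (leaves τc)
      ... | true  = just τc
      ... | false = just τf

  data History : Set where
    start : Config → History
    snoc  : History → Tx → Config → History

  histLength : History → ℕ
  histLength (start _)    = 0
  histLength (snoc h _ _) = suc (histLength h)

  record Run : Set where
    constructor run
    field
      hist : History
      tree : Tree
  open Run public

  initRun : Config → Run
  initRun c = run (start c) (leaf c)

  -- step, with monitoring window k; nothing signals an undefined operation.
  step : ℕ → Run → Tx → Maybe Run
  step k (run H τ) t with height (extend τ t) ≤? k
  ... | yes _ = just (run H (extend τ t))
  ... | no  _ =
    prune (extend τ t) >>= λ τ'' →
    nextTx τ >>= λ t₀ →
    just (run (snoc H t₀ (root τ'')) τ'')

  steps : ℕ → Run → List Tx → Maybe Run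
  steps k r []       = just r
  steps k r (t ∷ ts) = step k r t >>= λ r' → steps k r' ts

-- Every reachable monitoring tree is perfect: all its leaves lie at the same
-- depth.  extend raises that depth by one, innerprune keeps it (it only
-- replaces a binary node by a unary one over an equally deep subtree) and
-- prune lowers it by one, so after m steps with window k the tree is perfect
-- of height m ⊓ k.  Once m ≥ k, extending yields height k + 1 > k, so step
-- prunes, prune is defined because the tree is not a leaf, and exactly one
-- transaction, the root's nextTx, is appended to the history.

module Submission where

open import Defs
open import Data.Nat using (ℕ; suc; _≤_; _<_; _⊓_; _≤?_; _+_)
open import Data.Nat.Properties
  using (⊔-idem; 1+n≰n; <⇒≤; <-≤-connex; n≤1+n; ≤-trans; +-identityʳ; +-suc; m≤n⇒m⊓n≡m; m≥n⇒m⊓n≡n)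
open import Data.Bool using (true; false)
open import Data.Bool.ListAction using (all)
open import Data.List using (List; length; []; _∷_)
open import Data.Maybe using (just)
open import Data.Maybe.Properties using (just-injective)
open import Data.Product using (_×_; ∃; ∃₂; _,_)
open import Data.Sum using (inj₁; inj₂)
open import Relation.Binary.PropositionalEquality using (_≡_; refl; sym; trans; cong; subst)
open import Relation.Nullary using (yes; no; contradiction)

module _ (M : Model) where
  open Model M

  data Perfect : ℕ → Tree M → Set where
    leaf  : ∀ c → Perfect 0 (leaf c)
    node1 : ∀ {n τ} c t → Perfect n τ → Perfect (suc n) (node1 c t τ)
    node2 : ∀ {n τc τf} c t → Perfect n τc → Perfect n τf → Perfect (suc n) (node2 c t τc τf)

  height-perfect : ∀ {n τ} → Perfect n τ → height M τ ≡ n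
  height-perfect (leaf c)          = refl
  height-perfect (node1 c t p)     = cong suc (height-perfect p)
  height-perfect (node2 c t pc pf) rewrite height-perfect pc | height-perfect pf = cong suc (⊔-idem _)

  extend-perfect : ∀ {n τ} t → Perfect n τ → Perfect (suc n) (extend M τ t)
  extend-perfect t (leaf l) with applyTx t l
  ... | commit _    = node1 l t (leaf _)
  ... | fail _      = node1 l t (leaf _)
  ... | pending _ _ = node2 l t (leaf _) (leaf _)
  extend-perfect t (node1 c t' p)     = node1 c t' (extend-perfect t p)
  extend-perfect t (node2 c t' pc pf) = node2 c t' (extend-perfect t pc) (extend-perfect t pf)

  innerprune-perfect : ∀ {n τ} → Perfect n τ → Perfect n (innerprune M τ)
  innerprune-perfect (leaf c)      = leaf c
  innerprune-perfect (node1 c t p) = node1 c t (innerprune-perfect p)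
  innerprune-perfect (node2 {τc = τc} c t pc pf)
    with all (λ l → allMonitoringCommit M l t) (leaves M (innerprune M τc))
       | all (λ l → oneMonitoringFail M l t) (leaves M (innerprune M τc))
  ... | true  | _     = node1 c t (innerprune-perfect pc)
  ... | false | true  = node1 c t (innerprune-perfect pf)
  ... | false | false = node2 c t (innerprune-perfect pc) (innerprune-perfect pf)

  prune-perfect : ∀ {n τ} → Perfect (suc n) τ → ∃ λ τ' → prune M τ ≡ just τ' × Perfect n τ'
  prune-perfect {τ = τ} p with innerprune M τ | innerprune-perfect p
  ... | _ | node1 c t p₁ = _ , refl , p₁
  ... | _ | node2 {τc = τc} c t pc pf
    with all (λ l → allMonitoringCommitWithTimeout M l t) (leaves M τc)
  ... | true  = _ , refl , pc
  ... | false = _ , refl , pf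

  nextTx-perfect : ∀ {n τ} → Perfect (suc n) τ → ∃ λ t → nextTx M τ ≡ just t
  nextTx-perfect (node1 c t _)   = t , refl
  nextTx-perfect (node2 c t _ _) = t , refl

  step-filling : ∀ {k n τ} H t → Perfect n τ → n < k →
    step M k (run H τ) t ≡ just (run H (extend M τ t))
  step-filling {k} {τ = τ} H t p n<k with height M (extend M τ t) ≤? k
  ... | yes _    = refl
  ... | no  h≰k = contradiction (subst (_≤ k) (sym (height-perfect (extend-perfect t p))) n<k) h≰k

  step-full : ∀ {w τ} H t → Perfect (suc w) τ →
    ∃₂ λ t₀ τ' → step M (suc w) (run H τ) t ≡ just (run (snoc H t₀ (root M τ')) τ')
                 × Perfect (suc w) τ'
  step-full {w} {τ} H t p with height M (extend M τ t) ≤? suc w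
  ... | yes h≤k = contradiction (subst (_≤ suc w) (height-perfect (extend-perfect t p)) h≤k) 1+n≰n
  ... | no  _   with prune-perfect (extend-perfect t p) | nextTx-perfect p
  ... | τ' , pruned , p' | t₀ , next rewrite pruned | next = t₀ , τ' , refl , p'

  step-perfect : ∀ {w} m r t → Perfect (m ⊓ suc w) (tree r) →
    ∃ λ r' → step M (suc w) r t ≡ just r' × Perfect (suc m ⊓ suc w) (tree r')
  step-perfect {w} m r t p with <-≤-connex m (suc w)
  ... | inj₁ m<k rewrite m≤n⇒m⊓n≡m (<⇒≤ m<k) | m≤n⇒m⊓n≡m m<k =
    _ , step-filling (hist r) t p m<k , extend-perfect t p
  ... | inj₂ k≤m rewrite m≥n⇒m⊓n≡n k≤m | m≥n⇒m⊓n≡n (≤-trans k≤m (n≤1+n m)) =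
    let t₀ , τ' , stepped , p' = step-full (hist r) t p in _ , stepped , p'

  steps-perfect : ∀ {w} m r ts → Perfect (m ⊓ suc w) (tree r) →
    ∃ λ r' → steps M (suc w) r ts ≡ just r' × Perfect ((m + length ts) ⊓ suc w) (tree r')
  steps-perfect m r [] p rewrite +-identityʳ m = r , refl , p
  steps-perfect m r (t ∷ ts) p with step-perfect m r t p
  ... | r₁ , stepped , p₁ rewrite stepped | +-suc m (length ts) = steps-perfect (suc m) r₁ ts p₁

  full-step-extends-history : ∀ {w} r r' t → Perfect (suc w) (tree r) → step M (suc w) r t ≡ just r' →
    ∃₂ λ t₀ c → hist r' ≡ snoc (hist r) t₀ c
  full-step-extends-history r r' t p stepped =
    let t₀ , τ' , stepped' , _ = step-full (hist r) t p
    in t₀ , root M τ' , cong hist (just-injective (trans (sym stepped) stepped'))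

corollary1 : (M : Model) (k : ℕ) → 1 ≤ k → (c₀ : Model.Config M) →
    ((ts : List (Model.Tx M)) → ∃ λ r → steps M k (initRun M c₀) ts ≡ just r)
    × ((ts : List (Model.Tx M)) (t : Model.Tx M) (r r' : Run M) →
       k ≤ length ts →
       steps M k (initRun M c₀) ts ≡ just r →
       step M k r t ≡ just r' →
       ∃₂ λ t₀ c → Run.hist r' ≡ snoc (Run.hist r) t₀ c)
corollary1 M (suc w) _ c₀ =
    (λ ts → let r , ran , _ = reached ts in r , ran)
  , λ ts t r r' full ran stepped →
      let r₀ , ran₀ , p = reached ts
          r₀≡r          = just-injective (trans (sym ran₀) ran)
          p-full        = subst (λ d → Perfect M d (tree r₀)) (m≥n⇒m⊓n≡n full) p
      in full-step-extends-history M r r' t (subst (λ r → Perfect M _ (tree r)) r₀≡r p-full) stepped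
  where
  reached : (ts : List (Model.Tx M)) →
    ∃ λ r → steps M (suc w) (initRun M c₀) ts ≡ just r × Perfect M (length ts ⊓ suc w) (tree r)
  reached ts = steps-perfect M 0 (initRun M c₀) ts (leaf c₀)
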